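{- Let $z:[n]\to[k]$ be any map and let $\gamma\in\ker_{\mathbb Z}A_{n,z}$ be nonzero, $f=x^{\gamma^+}-x^{\gamma^- }$. Then there exist $f'\in I_{\mathcal M_{n,z}}$ and $f''\in I_{A_{n,z}}$ with $\deg f''=\deg f$ and $f=f'+f''$, where $f''=x^{\gamma''^+}-x^{\gamma''^- }$ for some $\gamma''\in\ker_{\mathbb Z}A_{n,z}$ for which there are vertices $u,v,w\in[n]$ with $z(u)=z(w)$ such that $\gamma''_{uv}$ and $\gamma''_{vw}$ are nonzero and of opposite signs.
   Context: $K$ is a field; variables $x_{uv}$ of $K[x_{uv}:1\le u<v\le n]$ are indexed by 2-subsets of $[n]$, as are coordinates of $\mathbb Z^{\binom n2}$. $A_{n,z}$ is the matrix obtained by stacking the vertex-edge incidence matrix of $K_n$ on top of the $\binom{k+1}2\times\binom n2$ matrix whose rows are indexed by pairs $(i,j)$, $1\le i\le j\le k$, and whose column $\{u,v\}$ has a single $1$ in row $(\min(z(u),z(v)),\max(z(u),z(v)))$. For $\gamma$, $\gamma^\pm=\max(\pm\gamma,0)$ entrywise, $x^\alpha=\prod x_{uv}^{\alpha_{uv}}$. $I_{A_{n,z}}$ is the ideal generated by all $x^{\gamma^+}-x^{\gamma^- }$, $\gamma\in\ker_{\mathbb Z}A_{n,z}$ (the toric ideal of $A_{n,z}$; these binomials are homogeneous). $\mathcal M_{n,z}=\{\gamma\in\ker_{\mathbb Z}A_{n,z}:\|\gamma\|_1=4\}$ and $I_{\mathcal M_{n,z}}$ is the ideal generated by $\{x^{\gamma^+}-x^{\gamma^-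 }:\gamma\in\mathcal M_{n,z}\}$. -}

module Defs where

open import Level using (Level; _⊔_)
open import Data.Nat as ℕ using (ℕ)
open import Data.Integer as ℤ using (ℤ; +_; -[1+_])
open import Data.Fin as F using (Fin)
open import Data.Fin.Properties using (_<?_; _≟_)
open import Data.List as L using (List; []; _∷_; allFin; concatMap; map; foldr; _++_)
open import Data.Product using (Σ; _×_; _,_; ∃)
open import Data.Bool using (Bool; true; false; if_then_else_; _∧_)
open import Relation.Nullary using (¬_; yes; no; Dec)
open import Relation.Nullary.Decidable using (⌊_⌋)
open import Relation.Binary.PropositionalEquality using (_≡_)
open import Algebra.Bundles using (CommutativeRing)

record IsField {c ℓ : Level} (K : CommutativeRing c ℓ) : Set (c ⊔ ℓ) where
  open CommutativeRing K
  field
    0≉1     : ¬ (0# ≈ 1#)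
    inverse : ∀ x → ¬ (x ≈ 0#) → ∃ λ y → (x * y) ≈ 1#

-- 2-subsets {u,v} of [n], represented as (u , v , u < v).

Edge : ℕ → Set
Edge n = Σ (Fin n) λ u → Σ (Fin n) λ v → u F.< v

allEdges : (n : ℕ) → List (Edge n)
allEdges n = concatMap (λ u → concatMap (λ v → pick u v) (allFin n)) (allFin n)
  where
  pick : (u v : Fin n) → List (Edge n)
  pick u v with u <? v
  ... | yes p = (u , v , p) ∷ []
  ... | no _  = []

ZVec : ℕ → Set
ZVec n = Edge n → ℤ

Mono : ℕ → Set
Mono n = Edge n → ℕ

sumℤ : ∀ {n} → (Edge n → ℤ) → ℤ
sumℤ {n} f = foldr (λ e acc → f e ℤ.+ acc) (+ 0) (allEdges n)

sumℕ : ∀ {n} → (Edge n → ℕ) → ℕ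
sumℕ {n} f = foldr (λ e acc → f e ℕ.+ acc) 0 (allEdges n)

posPart : ℤ → ℕ
posPart (+ m)    = m
posPart -[1+ _ ] = 0

negPart : ℤ → ℕ
negPart (+ _)    = 0
negPart -[1+ m ] = ℕ.suc m

_⁺ : ∀ {n} → ZVec n → Mono n
(γ ⁺) e = posPart (γ e)

_⁻ : ∀ {n} → ZVec n → Mono n
(γ ⁻) e = negPart (γ e)

norm1 : ∀ {n} → ZVec n → ℕ
norm1 γ = sumℕ (λ e → ℤ.∣ γ e ∣)

totalDeg : ∀ {n} → Mono n → ℕ
totalDeg α = sumℕ α

-- entry γ_{uv} for vertices u, v (the coordinate of the 2-subset {u,v});
-- by convention 0 when u = v (there is no such coordinate)
entry : ∀ {n} → ZVec n → Fin n → Fin n → ℤ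
entry γ u v with u <? v | v <? u
... | yes p | _     = γ (u , v , p)
... | no _  | yes q = γ (v , u , q)
... | no _  | no _  = + 0

incident : ∀ {n} → Fin n → Edge n → Bool
incident w (u , v , _) = ⌊ w ≟ u ⌋ Data.Bool.∨ ⌊ w ≟ v ⌋
  where import Data.Bool

minF maxF : ∀ {k} → Fin k → Fin k → Fin k
minF a b with a <? b
... | yes _ = a
... | no _  = b
maxF a b with a <? b
... | yes _ = b
... | no _  = a

-- column {u,v} of the colour block has its 1 in row (min(z u,z v), max(z u,z v))
colourRow : ∀ {n k} → (Fin n → Fin k) → Fin k → Fin k → Edge n → Bool
colourRow z i j (u , v , _) =
  ⌊ minF (z u) (z v) ≟ i ⌋ ∧ ⌊ maxF (z u) (z v) ≟ j ⌋

record InKer {n k : ℕ} (z : Fin n → Fin k) (γ : ZVec n) : Set where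
  field
    vertexRows : ∀ (w : Fin n) →
      sumℤ (λ e → if incident w e then γ e else + 0) ≡ + 0
    colourRows : ∀ (i j : Fin k) → i F.≤ j →
      sumℤ (λ e → if colourRow z i j e then γ e else + 0) ≡ + 0

InM : ∀ {n k} → (Fin n → Fin k) → ZVec n → Set
InM z γ = InKer z γ × norm1 γ ≡ 4

-- The polynomial ring K[x_e : e ∈ Edge n].
-- A polynomial is a finite formal sum of terms c·x^α (a list of terms);
-- two polynomials are equal iff all their coefficients agree in K.

module Poly {c ℓ : Level} (K : CommutativeRing c ℓ) (n : ℕ) where
  open CommutativeRing K

  Pol : Set c
  Pol = List (Carrier × Mono n)

  sameMono : Mono n → Mono n → Bool
  sameMono α β = foldr (λ e b → ⌊ α e ℕ.≟ β e ⌋ ∧ b) true (allEdges n)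

  coeff : Pol → Mono n → Carrier
  coeff p α = foldr (λ t acc → if sameMono (Data.Product.proj₂ t) α
                                 then Data.Product.proj₁ t + acc else acc) 0# p
    where import Data.Product

  _≈P_ : Pol → Pol → Set ℓ
  p ≈P q = ∀ α → coeff p α ≈ coeff q α

  _+P_ : Pol → Pol → Pol
  p +P q = p ++ q

  _*P_ : Pol → Pol → Pol
  p *P q = concatMap (λ s → map (λ t → (Data.Product.proj₁ s * Data.Product.proj₁ t
                                       , λ e → Data.Product.proj₂ s e ℕ.+ Data.Product.proj₂ t e)) q) p
    where import Data.Product

  0P : Pol
  0P = []

  1P : Pol
  1P = (1# , λ _ → 0) ∷ []

  monomial : Mono n → Pol
  monomial α = (1# , α) ∷ []

  binom : ZVec n → Pol
  binom γ = (1# , γ ⁺) ∷ (- 1# , γ ⁻) ∷ []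

  combo : List (Pol × ZVec n) → Pol
  combo = foldr (λ t acc → (Data.Product.proj₁ t *P binom (Data.Product.proj₂ t)) +P acc) 0P
    where import Data.Product

  InBinomialIdeal : (S : ZVec n → Set) → Pol → Set (c ⊔ ℓ)
  InBinomialIdeal S f =
    ∃ λ (gens : List (Pol × ZVec n)) →
      All (λ t → S (Data.Product.proj₂ t)) gens × (f ≈P combo gens)
    where
    import Data.Product
    open import Data.List.Relation.Unary.All using (All)

  -- degree of the binomial x^{γ⁺} - x^{γ⁻} for γ ≠ 0 in the kernel
  -- (homogeneous, so both monomials have this total degree)
  degBinom : ZVec n → ℕ
  degBinom γ = totalDeg (γ ⁺)

-- Pick γ_uv > 0.  The row of vertex v in A_{n,z} gives γ_vw < 0; if z u = z w, γ itself
-- alternates and f′ = 0.  Otherwise the row of the colour class {z u, z v} gives an edge xy of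
-- that class with γ_xy < 0.  Unless u, v, w, x, y already contain an alternating path, the
-- 4-cycle δ = e_xv + e_wy − e_vw − e_yx lies in 𝓜_{n,z} (as z v = z y), subtracting it changes
-- only the negative part of γ, and γ″ = γ − δ alternates along u, v, x.  Then
--   x^{γ⁺} − x^{γ⁻} = x^m (x^{δ⁺} − x^{δ⁻}) + (x^{γ″⁺} − x^{γ″⁻})   with x^m x^{δ⁻} = x^{γ⁻},
-- the middle monomial x^m x^{δ⁺} = x^{γ″⁻} cancelling.  The remaining configuration y = w is
-- handled by the same argument for −γ along w, v, u, where it cannot occur again.

module Submission where

open import Defs
open import Level using (Level; _⊔_)
open import Function using (_∘_; id)
open import Algebra.Bundles using (CommutativeRing)
open import Data.Bool using (Bool; true; false; if_then_else_; _∧_)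
open import Data.Empty.Irrelevant renaming (⊥-elim to ⊥-elim-irr)
open import Data.Nat as ℕ using (ℕ; zero; suc; _∸_)
import Data.Nat.Properties as ℕ
open import Data.Integer as ℤ using (ℤ; +_; -[1+_]; _+_; _-_; -_; _<_; _≤_)
import Data.Integer.Properties as ℤ
open import Data.Integer.Tactic.RingSolver using (solve-∀)
open import Algebra.Properties.CommutativeSemigroup ℤ.+-commutativeSemigroup using (interchange)
open import Data.Fin as F using (Fin)
import Data.Fin.Properties as F
open import Data.Product using (_×_; _,_; ∃; proj₁; proj₂)
open import Data.Product.Properties using (≡-dec)
open import Data.Sum using (_⊎_; inj₁; inj₂; swap; [_,_]′)
open import Data.List using (List; []; _∷_; _++_; foldr; concatMap; tabulate; allFin)
open import Data.List.Properties using (foldr-fusion; foldr-cong; concatMap-cong)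
open import Data.List.Membership.Propositional using (_∈_)
open import Data.List.Membership.Propositional.Properties using (∈-concatMap⁺; ∈-allFin)
open import Data.List.Relation.Unary.All as All using (All; all?; []; _∷_)
open import Data.List.Relation.Unary.All.Properties using (¬All⇒Any¬)
open import Data.List.Relation.Unary.Any as Any using (here; there)
open import Relation.Nullary using (¬_; yes; no; contradiction)
open import Relation.Nullary.Decidable using (⌊_⌋)
open import Relation.Binary.Definitions using (DecidableEquality; tri<; tri≈; tri>)
open import Relation.Binary.PropositionalEquality
  using (_≡_; _≢_; refl; sym; trans; cong; cong₂; subst; subst₂; module ≡-Reasoning)

private
  variable
    a b : Level
    A : Set a
    B : Set b

neg>0⇒<0 : ∀ {x} → + 0 < - x → x < + 0
neg>0⇒<0 {x} = subst (_< + 0) (ℤ.neg-involutive x) ∘ ℤ.neg-mono-<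

neg<0⇒>0 : ∀ {x} → - x < + 0 → + 0 < x
neg<0⇒>0 {x} = subst (+ 0 <_) (ℤ.neg-involutive x) ∘ ℤ.neg-mono-<

neg≤0⇒≥0 : ∀ {x} → - x ≤ + 0 → + 0 ≤ x
neg≤0⇒≥0 {x} = subst (+ 0 ≤_) (ℤ.neg-involutive x) ∘ ℤ.neg-mono-≤

neg≥0⇒≤0 : ∀ {x} → + 0 ≤ - x → x ≤ + 0
neg≥0⇒≤0 {x} = subst (_≤ + 0) (ℤ.neg-involutive x) ∘ ℤ.neg-mono-≤

≤0⇒-1<0 : ∀ {x} → x ≤ + 0 → x - + 1 < + 0
≤0⇒-1<0 {+ zero}   _          = ℤ.-<+
≤0⇒-1<0 { -[1+ _ ]} _         = ℤ.-<+
≤0⇒-1<0 {+ suc _}  (ℤ.+≤+ ())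

∑ : List A → (A → ℤ) → ℤ
∑ xs f = foldr (λ x acc → f x + acc) (+ 0) xs

∑-cong : (xs : List A) {f g : A → ℤ} → (∀ x → f x ≡ g x) → ∑ xs f ≡ ∑ xs g
∑-cong xs f≗g = foldr-cong (λ x acc → cong (_+ acc) (f≗g x)) refl xs

∑-++ : (xs ys : List A) (f : A → ℤ) → ∑ (xs ++ ys) f ≡ ∑ xs f + ∑ ys f
∑-++ []       ys f = sym (ℤ.+-identityˡ _)
∑-++ (x ∷ xs) ys f = trans (cong (_+_ (f x)) (∑-++ xs ys f)) (sym (ℤ.+-assoc (f x) _ _))

∑-concatMap : (g : A → List B) (xs : List A) (f : B → ℤ) →
              ∑ (concatMap g xs) f ≡ ∑ xs (λ x → ∑ (g x) f)
∑-concatMap g []       f = refl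
∑-concatMap g (x ∷ xs) f = trans (∑-++ (g x) _ f) (cong (_+_ (∑ (g x) f)) (∑-concatMap g xs f))

∑-+ : (xs : List A) (f g : A → ℤ) → ∑ xs (λ x → f x + g x) ≡ ∑ xs f + ∑ xs g
∑-+ []       f g = refl
∑-+ (x ∷ xs) f g = trans (cong (_+_ (f x + g x)) (∑-+ xs f g)) (interchange (f x) (g x) _ _)

∑-neg : (xs : List A) (f : A → ℤ) → ∑ xs (λ x → - f x) ≡ - ∑ xs f
∑-neg xs f = sym (foldr-fusion -_ (+ 0) (λ x acc → ℤ.neg-distrib-+ (f x) acc) xs)

∑-- : (xs : List A) (f g : A → ℤ) → ∑ xs (λ x → f x - g x) ≡ ∑ xs f - ∑ xs g
∑-- xs f g = trans (∑-+ xs f (λ x → - g x)) (cong (_+_ (∑ xs f)) (∑-neg xs g))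

pos-∑ : (xs : List A) (f : A → ℕ) → + foldr (λ x acc → f x ℕ.+ acc) 0 xs ≡ ∑ xs (λ x → + f x)
pos-∑ xs f = foldr-fusion +_ 0 (λ _ _ → refl) xs

∑-tabulate-zero : ∀ {n} (h : Fin n → A) (f : A → ℤ) → (∀ j → f (h j) ≡ + 0) → ∑ (tabulate h) f ≡ + 0
∑-tabulate-zero {n = zero}  h f zeros = refl
∑-tabulate-zero {n = suc n} h f zeros = cong₂ _+_ (zeros F.zero) (∑-tabulate-zero (h ∘ F.suc) f (zeros ∘ F.suc))

∑-tabulate-point : ∀ {n} (h : Fin n → A) (f : A → ℤ) (i : Fin n) →
                   (∀ j → j ≢ i → f (h j) ≡ + 0) → ∑ (tabulate h) f ≡ f (h i)
∑-tabulate-point h f F.zero others =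
  trans (cong (_+_ (f (h F.zero))) (∑-tabulate-zero (h ∘ F.suc) f (λ j → others (F.suc j) λ ())))
        (ℤ.+-identityʳ _)
∑-tabulate-point h f (F.suc i) others =
  trans (cong₂ _+_ (others F.zero λ ())
                   (∑-tabulate-point (h ∘ F.suc) f i (λ j j≢i → others (F.suc j) (j≢i ∘ F.suc-injective))))
        (ℤ.+-identityˡ _)

∑-nonneg : {xs : List A} {f : A → ℤ} → All (λ y → + 0 ≤ f y) xs → + 0 ≤ ∑ xs f
∑-nonneg []       = ℤ.≤-refl
∑-nonneg (p ∷ ps) = ℤ.+-mono-≤ p (∑-nonneg ps)

term≤∑ : {xs : List A} {f : A → ℤ} {x : A} → All (λ y → + 0 ≤ f y) xs → x ∈ xs → f x ≤ ∑ xs f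
term≤∑ {f = f} (_∷_ {y} _ nonneg) (here refl) =
  ℤ.≤-trans (ℤ.≤-reflexive (sym (ℤ.+-identityʳ (f y)))) (ℤ.+-monoʳ-≤ (f y) (∑-nonneg nonneg))
term≤∑ {f = f} (_∷_ {y} y≥0 nonneg) (there x∈xs) =
  ℤ.≤-trans (term≤∑ nonneg x∈xs)
            (ℤ.≤-trans (ℤ.≤-reflexive (sym (ℤ.+-identityˡ _))) (ℤ.+-monoˡ-≤ _ y≥0))

∑≡0⇒negative-term : {xs : List A} {f : A → ℤ} {x : A} → ∑ xs f ≡ + 0 → x ∈ xs → + 0 < f x →
                    ∃ λ y → f y < + 0
∑≡0⇒negative-term {xs = xs} {f = f} ∑≡0 x∈xs fx>0 with all? (λ y → + 0 ℤ.≤? f y) xs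
... | yes nonneg = contradiction (subst (_ ≤_) ∑≡0 (term≤∑ nonneg x∈xs)) (ℤ.<⇒≱ fx>0)
... | no ¬nonneg with Any.satisfied (¬All⇒Any¬ (λ y → + 0 ℤ.≤? f y) xs ¬nonneg)
...   | y , fy≱0 = y , ℤ.≰⇒> fy≱0

≮∧≯⇒≡ : ∀ {n} {p q : Fin n} → ¬ p F.< q → ¬ q F.< p → p ≡ q
≮∧≯⇒≡ p≮q q≮p = F.≤-antisym (ℕ.≮⇒≥ q≮p) (ℕ.≮⇒≥ p≮q)

module _ {n : ℕ} where

  edge : (p q : Fin n) → .(p ≢ q) → Edge n
  edge p q p≢q with p F.<? q | q F.<? p
  ... | yes p<q | _       = p , q , p<q
  ... | no _    | yes q<p = q , p , q<p
  ... | no p≮q  | no q≮p  = ⊥-elim-irr (p≢q (≮∧≯⇒≡ p≮q q≮p))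

  entry-edge : (γ : ZVec n) (p q : Fin n) .(p≢q : p ≢ q) → entry γ p q ≡ γ (edge p q p≢q)
  entry-edge γ p q p≢q with p F.<? q | q F.<? p
  ... | yes _ | _     = refl
  ... | no _  | yes _ = refl
  ... | no p≮q  | no q≮p  = ⊥-elim-irr (p≢q (≮∧≯⇒≡ p≮q q≮p))

  entry-comm : (γ : ZVec n) (p q : Fin n) → entry γ p q ≡ entry γ q p
  entry-comm γ p q with p F.<? q | q F.<? p
  ... | yes p<q | yes q<p = contradiction q<p (F.<-asym p<q)
  ... | yes _   | no _    = refl
  ... | no _    | yes _   = refl
  ... | no _    | no _    = refl

  entry>0-comm : (γ : ZVec n) (p q : Fin n) → + 0 < entry γ p q → + 0 < entry γ q p
  entry>0-comm γ p q = subst (+ 0 <_) (entry-comm γ p q)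

  entry<0-comm : (γ : ZVec n) (p q : Fin n) → entry γ p q < + 0 → entry γ q p < + 0
  entry<0-comm γ p q = subst (_< + 0) (entry-comm γ p q)

  entry≤0-comm : (γ : ZVec n) (p q : Fin n) → entry γ p q ≤ + 0 → entry γ q p ≤ + 0
  entry≤0-comm γ p q = subst (_≤ + 0) (entry-comm γ p q)

  entry-diag : (γ : ZVec n) (p : Fin n) → entry γ p p ≡ + 0
  entry-diag γ p with p F.<? p
  ... | yes p<p = contradiction p<p (F.<-irrefl refl)
  ... | no _    = refl

  _≟ᴱ_ : DecidableEquality (Edge n)
  _≟ᴱ_ = ≡-dec F._≟_ (≡-dec F._≟_ (λ p q → yes (F.<-irrelevant p q)))

  _∈ᴱ_ : Fin n → Edge n → Set
  w ∈ᴱ (a , b , _) = w ≡ a ⊎ w ≡ b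

  ∈ᴱ-edge : (p q : Fin n) .(p≢q : p ≢ q) → p ∈ᴱ edge p q p≢q × q ∈ᴱ edge p q p≢q
  ∈ᴱ-edge p q p≢q with p F.<? q | q F.<? p
  ... | yes _ | _     = inj₁ refl , inj₂ refl
  ... | no _  | yes _ = inj₂ refl , inj₁ refl
  ... | no p≮q  | no q≮p  = ⊥-elim-irr (p≢q (≮∧≯⇒≡ p≮q q≮p))

  ∈ᴱ-edge⁻ : {w p q : Fin n} .(p≢q : p ≢ q) → w ∈ᴱ edge p q p≢q → w ≡ p ⊎ w ≡ q
  ∈ᴱ-edge⁻ {w} {p} {q} p≢q w∈e with p F.<? q | q F.<? p
  ∈ᴱ-edge⁻ p≢q w∈e | yes _ | _     = w∈e
  ∈ᴱ-edge⁻ p≢q w∈e | no _  | yes _ = swap w∈e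
  ∈ᴱ-edge⁻ p≢q w∈e | no p≮q  | no q≮p  = ⊥-elim-irr (p≢q (≮∧≯⇒≡ p≮q q≮p))

  ∉ᴱ-edge : {w p q : Fin n} .{p≢q : p ≢ q} → w ≢ p → w ≢ q → ¬ w ∈ᴱ edge p q p≢q
  ∉ᴱ-edge {p≢q = p≢q} w≢p w≢q w∈e with ∈ᴱ-edge⁻ p≢q w∈e
  ... | inj₁ w≡p = w≢p w≡p
  ... | inj₂ w≡q = w≢q w≡q

  ∈ᴱ∧∉ᴱ⇒≢ : {w : Fin n} {e e′ : Edge n} → w ∈ᴱ e → ¬ w ∈ᴱ e′ → e ≢ e′
  ∈ᴱ∧∉ᴱ⇒≢ {w} w∈e w∉e′ refl = w∉e′ w∈e

  edgesFrom : Fin n → Fin n → List (Edge n)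
  edgesFrom u v with u F.<? v
  ... | yes u<v = (u , v , u<v) ∷ []
  ... | no _    = []

  -- Defs keeps its enumerator of pairs local to allEdges; unification recovers it as `pick`.
  allEdges-pairs : allEdges n ≡ concatMap (λ u → concatMap (edgesFrom u) (allFin n)) (allFin n)
  allEdges-pairs = trans unfold (concatMap-cong (λ u → concatMap-cong (pick≗edgesFrom u) (allFin n)) (allFin n))
    where
    pick : Fin n → Fin n → List (Edge n)
    pick = _
    unfold : allEdges n ≡ concatMap (λ u → concatMap (pick u) (allFin n)) (allFin n)
    unfold = refl
    pick≗edgesFrom : ∀ u v → pick u v ≡ edgesFrom u v
    pick≗edgesFrom u v with u F.<? v
    ... | yes _ = refl
    ... | no _  = refl

  ∈-allEdges : (e : Edge n) → e ∈ allEdges n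
  ∈-allEdges e@(a , b , a<b) =
    subst (e ∈_) (sym allEdges-pairs)
      (∈-concatMap⁺ _ (Any.map (λ { refl → ∈-concatMap⁺ _ (Any.map (λ { refl → e∈edgesFrom }) (∈-allFin b)) })
                             (∈-allFin a)))
    where
    e∈edgesFrom : e ∈ edgesFrom a b
    e∈edgesFrom with a F.<? b
    ... | yes a<b′ = here (cong (λ h → a , b , h) (F.<-irrelevant a<b a<b′))
    ... | no a≮b = contradiction a<b a≮b

  ∑-allEdges-point : (f : Edge n → ℤ) (e : Edge n) → (∀ e′ → e′ ≢ e → f e′ ≡ + 0) → sumℤ f ≡ f e
  ∑-allEdges-point f e@(a , b , a<b) others = begin
    sumℤ f                                                          ≡⟨ cong (λ es → ∑ es f) allEdges-pairs ⟩
    ∑ (concatMap (λ u → concatMap (edgesFrom u) (allFin n)) (allFin n)) f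
      ≡⟨ ∑-concatMap _ (allFin n) f ⟩
    ∑ (allFin n) (λ u → ∑ (concatMap (edgesFrom u) (allFin n)) f)
      ≡⟨ ∑-cong (allFin n) (λ u → ∑-concatMap _ (allFin n) f) ⟩
    ∑ (allFin n) (λ u → ∑ (allFin n) (λ v → ∑ (edgesFrom u v) f))
      ≡⟨ ∑-tabulate-point id (λ u → ∑ (allFin n) (λ v → ∑ (edgesFrom u v) f)) a
           (λ u u≢a → ∑-tabulate-zero id _ (λ v → off u v (u≢a ∘ proj₁))) ⟩
    ∑ (allFin n) (λ v → ∑ (edgesFrom a v) f)
      ≡⟨ ∑-tabulate-point id (λ v → ∑ (edgesFrom a v) f) b (λ v v≢b → off a v (v≢b ∘ proj₂)) ⟩
    ∑ (edgesFrom a b) f                                              ≡⟨ at-e ⟩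
    f e                                                              ∎
    where
    open ≡-Reasoning
    off : ∀ u v → ¬ (u ≡ a × v ≡ b) → ∑ (edgesFrom u v) f ≡ + 0
    off u v ≢ab with u F.<? v
    ... | no _    = refl
    ... | yes u<v = cong (_+ + 0) (others _ λ { refl → ≢ab (refl , refl) })
    at-e : ∑ (edgesFrom a b) f ≡ f e
    at-e with a F.<? b
    ... | yes a<b′ = trans (ℤ.+-identityʳ _) (cong (λ h → f (a , b , h)) (F.<-irrelevant a<b′ a<b))
    ... | no a≮b = contradiction a<b a≮b

  entry-< : (γ : ZVec n) {a b : Fin n} (a<b : a F.< b) → entry γ a b ≡ γ (a , b , a<b)
  entry-< γ {a} {b} a<b with a F.<? b
  ... | yes a<b′ = cong (λ h → γ (a , b , h)) (F.<-irrelevant a<b′ a<b)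
  ... | no a≮b  = contradiction a<b a≮b

  entry>0⇒≢ : (γ : ZVec n) {p q : Fin n} → + 0 < entry γ p q → p ≢ q
  entry>0⇒≢ γ {p} pq>0 refl = ℤ.<-irrefl (sym (entry-diag γ p)) pq>0

  entry<0⇒≢ : (γ : ZVec n) {p q : Fin n} → entry γ p q < + 0 → p ≢ q
  entry<0⇒≢ γ {p} pq<0 refl = ℤ.<-irrefl (entry-diag γ p) pq<0

  incident⇒∈ᴱ : (w : Fin n) (e : Edge n) → incident w e ≡ true → w ∈ᴱ e
  incident⇒∈ᴱ w (a , b , _) inc with w F.≟ a | w F.≟ b
  ... | yes w≡a | _       = inj₁ w≡a
  ... | no _    | yes w≡b = inj₂ w≡b

  ∈ᴱ⇒incident : (w : Fin n) (e : Edge n) → w ∈ᴱ e → incident w e ≡ true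
  ∈ᴱ⇒incident w (a , b , _) (inj₁ refl) with w F.≟ w
  ... | yes _   = refl
  ... | no w≢w = contradiction refl w≢w
  ∈ᴱ⇒incident w (a , b , _) (inj₂ refl) with w F.≟ a | w F.≟ w
  ... | yes _ | _       = refl
  ... | no _  | yes _   = refl
  ... | no _  | no w≢w = contradiction refl w≢w

restrict : ∀ {n} → (Edge n → Bool) → ZVec n → ZVec n
restrict R γ e = if R e then γ e else + 0

row-partner : ∀ {n} (R : Edge n → Bool) (γ : ZVec n) {e : Edge n} → sumℤ (restrict R γ) ≡ + 0 →
              R e ≡ true → + 0 < γ e → ∃ λ e′ → R e′ ≡ true × γ e′ < + 0
row-partner R γ {e} row≡0 Re γe>0
  with ∑≡0⇒negative-term {f = restrict R γ} row≡0 (∈-allEdges e)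
         (subst (λ b → + 0 < (if b then γ e else + 0)) (sym Re) γe>0)
... | e′ , γe′<0 with R e′ in Re′
...   | true  = e′ , Re′ , γe′<0
...   | false = contradiction γe′<0 (ℤ.<-irrefl refl)

module _ {k : ℕ} where

  minF-comm : (a b : Fin k) → minF a b ≡ minF b a
  minF-comm a b with a F.<? b | b F.<? a
  ... | yes a<b | yes b<a = contradiction b<a (F.<-asym a<b)
  ... | yes _   | no _    = refl
  ... | no _    | yes _   = refl
  ... | no a≮b  | no b≮a  = sym (≮∧≯⇒≡ a≮b b≮a)

  maxF-comm : (a b : Fin k) → maxF a b ≡ maxF b a
  maxF-comm a b with a F.<? b | b F.<? a
  ... | yes a<b | yes b<a = contradiction b<a (F.<-asym a<b)
  ... | yes _   | no _    = refl
  ... | no _    | yes _   = refl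
  ... | no a≮b  | no b≮a  = ≮∧≯⇒≡ a≮b b≮a

  minF≤maxF : (a b : Fin k) → minF a b F.≤ maxF a b
  minF≤maxF a b with a F.<? b
  ... | yes a<b = ℕ.<⇒≤ a<b
  ... | no a≮b  = ℕ.≮⇒≥ a≮b

  minF-maxF-injective : (a b c d : Fin k) → minF a b ≡ minF c d → maxF a b ≡ maxF c d →
                        (a ≡ c × b ≡ d) ⊎ (a ≡ d × b ≡ c)
  minF-maxF-injective a b c d min≡ max≡ with a F.<? b | c F.<? d
  ... | yes _ | yes _ = inj₁ (min≡ , max≡)
  ... | yes _ | no _  = inj₂ (min≡ , max≡)
  ... | no _  | yes _ = inj₂ (max≡ , min≡)
  ... | no _  | no _  = inj₁ (max≡ , min≡)

  inColourRow : (i j a b : Fin k) → Bool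
  inColourRow i j a b = ⌊ minF a b F.≟ i ⌋ ∧ ⌊ maxF a b F.≟ j ⌋

  inColourRow-comm : (i j a b : Fin k) → inColourRow i j a b ≡ inColourRow i j b a
  inColourRow-comm i j a b = cong₂ (λ m M → ⌊ m F.≟ i ⌋ ∧ ⌊ M F.≟ j ⌋) (minF-comm a b) (maxF-comm a b)

  inColourRow-own : (a b : Fin k) → inColourRow (minF a b) (maxF a b) a b ≡ true
  inColourRow-own a b with minF a b F.≟ minF a b | maxF a b F.≟ maxF a b
  ... | yes _ | yes _ = refl
  ... | no ≢  | _     = contradiction refl ≢
  ... | yes _ | no ≢  = contradiction refl ≢

  inColourRow⇒ : {i j a b : Fin k} → inColourRow i j a b ≡ true → minF a b ≡ i × maxF a b ≡ j
  inColourRow⇒ {i} {j} {a} {b} inRow with minF a b F.≟ i | maxF a b F.≟ j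
  ... | yes min≡i | yes max≡j = min≡i , max≡j

colourRow-edge : ∀ {n k} (z : Fin n → Fin k) (i j : Fin k) (p q : Fin n) .(p≢q : p ≢ q) →
                 colourRow z i j (edge p q p≢q) ≡ inColourRow i j (z p) (z q)
colourRow-edge z i j p q p≢q with p F.<? q | q F.<? p
... | yes _ | _     = refl
... | no _  | yes _ = inColourRow-comm i j (z q) (z p)
... | no p≮q | no q≮p = ⊥-elim-irr (p≢q (≮∧≯⇒≡ p≮q q≮p))

module _ {n k : ℕ} {z : Fin n → Fin k} {γ : ZVec n} (γ∈ker : InKer z γ) where
  open InKer γ∈ker

  vertex-partner : (u v : Fin n) → + 0 < entry γ u v → ∃ λ w → entry γ v w < + 0
  vertex-partner u v uv>0
    with row-partner (incident v) γ (vertexRows v)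
           (∈ᴱ⇒incident v (edge u v (entry>0⇒≢ γ uv>0)) (proj₂ (∈ᴱ-edge u v _)))
           (subst (+ 0 <_) (entry-edge γ u v (entry>0⇒≢ γ uv>0)) uv>0)
  ... | e@(a , b , a<b) , v∈e , γe<0 with incident⇒∈ᴱ v e v∈e
  ...   | inj₁ refl = b , subst (_< + 0) (sym (entry-< γ a<b)) γe<0
  ...   | inj₂ refl = a , subst (_< + 0) (sym (trans (entry-comm γ b a) (entry-< γ a<b))) γe<0

  colour-partner : (u v : Fin n) → + 0 < entry γ u v →
                   ∃ λ x → ∃ λ y → z x ≡ z u × z y ≡ z v × entry γ x y < + 0
  colour-partner u v uv>0
    with row-partner (colourRow z (minF (z u) (z v)) (maxF (z u) (z v))) γ
           (colourRows _ _ (minF≤maxF (z u) (z v)))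
           (trans (colourRow-edge z _ _ u v (entry>0⇒≢ γ uv>0)) (inColourRow-own (z u) (z v)))
           (subst (+ 0 <_) (entry-edge γ u v (entry>0⇒≢ γ uv>0)) uv>0)
  ... | (a , b , a<b) , inRow , γe<0
    with inColourRow⇒ {a = z a} {b = z b} inRow
  ...   | min≡ , max≡ with minF-maxF-injective (z a) (z b) (z u) (z v) min≡ max≡
  ...     | inj₁ (za≡zu , zb≡zv) = a , b , za≡zu , zb≡zv , subst (_< + 0) (sym (entry-< γ a<b)) γe<0
  ...     | inj₂ (za≡zv , zb≡zu) =
    b , a , zb≡zu , za≡zv , subst (_< + 0) (sym (trans (entry-comm γ b a) (entry-< γ a<b))) γe<0

fromBool : Bool → ℤ
fromBool b = if b then + 1 else + 0

module _ {n : ℕ} where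

  𝟙 : Edge n → ZVec n
  𝟙 e e′ = fromBool ⌊ e′ ≟ᴱ e ⌋

  𝟙-same : (e : Edge n) → 𝟙 e e ≡ + 1
  𝟙-same e with e ≟ᴱ e
  ... | yes _   = refl
  ... | no e≢e = contradiction refl e≢e

  𝟙-other : {e e′ : Edge n} → e′ ≢ e → 𝟙 e e′ ≡ + 0
  𝟙-other {e} {e′} e′≢e with e′ ≟ᴱ e
  ... | yes e′≡e = contradiction e′≡e e′≢e
  ... | no _     = refl

  ∑-restrict-𝟙 : (R : Edge n → Bool) (e : Edge n) → sumℤ (restrict R (𝟙 e)) ≡ fromBool (R e)
  ∑-restrict-𝟙 R e = trans (∑-allEdges-point (restrict R (𝟙 e)) e off) at-e
    where
    off : ∀ e′ → e′ ≢ e → restrict R (𝟙 e) e′ ≡ + 0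
    off e′ e′≢e with R e′
    ... | true  = 𝟙-other e′≢e
    ... | false = refl
    at-e : restrict R (𝟙 e) e ≡ fromBool (R e)
    at-e with R e
    ... | true  = 𝟙-same e
    ... | false = refl

  fromBool-incident : (w p q : Fin n) .(p≢q : p ≢ q) →
                      fromBool (incident w (edge p q p≢q)) ≡ fromBool ⌊ w F.≟ p ⌋ + fromBool ⌊ w F.≟ q ⌋
  fromBool-incident w p q p≢q with w F.≟ p | w F.≟ q
  ... | yes refl | yes refl = ⊥-elim-irr (p≢q refl)
  ... | yes refl | no _     = cong fromBool (∈ᴱ⇒incident w (edge p q p≢q) (proj₁ (∈ᴱ-edge p q p≢q)))
  ... | no _     | yes refl = cong fromBool (∈ᴱ⇒incident w (edge p q p≢q) (proj₂ (∈ᴱ-edge p q p≢q)))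
  ... | no w≢p   | no w≢q   with incident w (edge p q p≢q) in inc
  ...   | true  = contradiction (incident⇒∈ᴱ w (edge p q p≢q) inc) (∉ᴱ-edge w≢p w≢q)
  ...   | false = refl

-- The symmetry γ ↦ −γ

module _ {n : ℕ} where

  -ᵛ_ : ZVec n → ZVec n
  (-ᵛ γ) e = - γ e

  _-ᵛ_ : ZVec n → ZVec n → ZVec n
  (γ -ᵛ δ) e = γ e - δ e

  entry-neg : (γ : ZVec n) (p q : Fin n) → entry (-ᵛ γ) p q ≡ - entry γ p q
  entry-neg γ p q with p F.<? q | q F.<? p
  ... | yes _ | _     = refl
  ... | no _  | yes _ = refl
  ... | no _  | no _  = refl

  entry-- : (γ δ : ZVec n) (p q : Fin n) → entry (γ -ᵛ δ) p q ≡ entry γ p q - entry δ p q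
  entry-- γ δ p q with p F.<? q | q F.<? p
  ... | yes _ | _     = refl
  ... | no _  | yes _ = refl
  ... | no _  | no _  = refl

  entry-cong : {γ γ′ : ZVec n} → (∀ e → γ e ≡ γ′ e) → (p q : Fin n) → entry γ p q ≡ entry γ′ p q
  entry-cong γ≗γ′ p q with p F.<? q | q F.<? p
  ... | yes _ | _     = γ≗γ′ _
  ... | no _  | yes _ = γ≗γ′ _
  ... | no _  | no _  = refl

  sumℤ-neg : (γ : ZVec n) → sumℤ (-ᵛ γ) ≡ - sumℤ γ
  sumℤ-neg γ = ∑-neg (allEdges n) γ

  restrict-neg : (R : Edge n → Bool) (γ : ZVec n) (e : Edge n) → restrict R (-ᵛ γ) e ≡ - restrict R γ e
  restrict-neg R γ e with R e
  ... | true  = refl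
  ... | false = refl

  restrict-- : (R : Edge n → Bool) (γ δ : ZVec n) (e : Edge n) →
               restrict R (γ -ᵛ δ) e ≡ restrict R γ e - restrict R δ e
  restrict-- R γ δ e with R e
  ... | true  = refl
  ... | false = refl

module _ {n k : ℕ} {z : Fin n → Fin k} where

  InKer-rowwise : {γ δ ε : ZVec n} →
                  (∀ R → sumℤ (restrict R γ) ≡ + 0 → sumℤ (restrict R δ) ≡ + 0 →
                         sumℤ (restrict R ε) ≡ + 0) →
                  InKer z γ → InKer z δ → InKer z ε
  InKer-rowwise rows γ∈ker δ∈ker = record
    { vertexRows = λ w → rows (incident w) (InKer.vertexRows γ∈ker w) (InKer.vertexRows δ∈ker w)
    ; colourRows = λ i j i≤j →
        rows (colourRow z i j) (InKer.colourRows γ∈ker i j i≤j) (InKer.colourRows δ∈ker i j i≤j)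
    }

  InKer-neg : {γ : ZVec n} → InKer z γ → InKer z (-ᵛ γ)
  InKer-neg {γ} γ∈ker = InKer-rowwise negated-row γ∈ker γ∈ker
    where
    negated-row : ∀ R → sumℤ (restrict R γ) ≡ + 0 → sumℤ (restrict R γ) ≡ + 0 →
                  sumℤ (restrict R (-ᵛ γ)) ≡ + 0
    negated-row R row≡0 _ = begin
      sumℤ (restrict R (-ᵛ γ))   ≡⟨ ∑-cong (allEdges n) (restrict-neg R γ) ⟩
      sumℤ (-ᵛ restrict R γ)     ≡⟨ sumℤ-neg (restrict R γ) ⟩
      - sumℤ (restrict R γ)      ≡⟨ cong -_ row≡0 ⟩
      + 0                        ∎
      where open ≡-Reasoning

  InKer-- : {γ δ : ZVec n} → InKer z γ → InKer z δ → InKer z (γ -ᵛ δ)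
  InKer-- {γ} {δ} = InKer-rowwise difference-row
    where
    difference-row : ∀ R → sumℤ (restrict R γ) ≡ + 0 → sumℤ (restrict R δ) ≡ + 0 →
                     sumℤ (restrict R (γ -ᵛ δ)) ≡ + 0
    difference-row R γ-row δ-row = begin
      sumℤ (restrict R (γ -ᵛ δ))                  ≡⟨ ∑-cong (allEdges n) (restrict-- R γ δ) ⟩
      ∑ (allEdges n) (λ e → restrict R γ e - restrict R δ e)
                                                  ≡⟨ ∑-- (allEdges n) (restrict R γ) (restrict R δ) ⟩
      sumℤ (restrict R γ) - sumℤ (restrict R δ)   ≡⟨ cong₂ _-_ γ-row δ-row ⟩
      + 0                                         ∎
      where open ≡-Reasoning

  InM-neg : {δ : ZVec n} → InM z δ → InM z (-ᵛ δ)
  InM-neg {δ} (δ∈ker , ‖δ‖≡4) =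
    InKer-neg δ∈ker ,
    trans (foldr-cong (λ e acc → cong (ℕ._+ acc) (ℤ.∣-i∣≡∣i∣ (δ e))) refl (allEdges n)) ‖δ‖≡4

OppositeSigns : ℤ → ℤ → Set
OppositeSigns a b = (+ 0 < a × b < + 0) ⊎ (a < + 0 × + 0 < b)

OppositeSigns-neg : {a b : ℤ} → OppositeSigns (- a) (- b) → OppositeSigns a b
OppositeSigns-neg (inj₁ (-a>0 , -b<0)) = inj₂ (neg>0⇒<0 -a>0 , neg<0⇒>0 -b<0)
OppositeSigns-neg (inj₂ (-a<0 , -b>0)) = inj₁ (neg<0⇒>0 -a<0 , neg>0⇒<0 -b>0)

Alternating : ∀ {n k} → (Fin n → Fin k) → ZVec n → Set
Alternating {n} z γ = ∃ λ (u : Fin n) → ∃ λ (v : Fin n) → ∃ λ (w : Fin n) →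
  z u ≡ z w × OppositeSigns (entry γ u v) (entry γ v w)

module _ {n k : ℕ} {z : Fin n → Fin k} where

  Alternating-cong : {γ γ′ : ZVec n} → (∀ e → γ e ≡ γ′ e) → Alternating z γ → Alternating z γ′
  Alternating-cong γ≗γ′ (u , v , w , zu≡zw , signs) =
    u , v , w , zu≡zw , subst₂ OppositeSigns (entry-cong γ≗γ′ u v) (entry-cong γ≗γ′ v w) signs

  Alternating-neg : {γ : ZVec n} → Alternating z (-ᵛ γ) → Alternating z γ
  Alternating-neg {γ} (u , v , w , zu≡zw , signs) =
    u , v , w , zu≡zw , OppositeSigns-neg (subst₂ OppositeSigns (entry-neg γ u v) (entry-neg γ v w) signs)

-- The admissible values d of a move at an entry g of γ: subtracting d alters only the negative
-- part of g (Step⁻), or only its positive part (Step⁺).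
data Step⁻ : ℤ → ℤ → Set where
  unchanged : ∀ {g} → Step⁻ g (+ 0)
  decrease  : ∀ {g} → g ≤ + 0 → Step⁻ g (+ 1)
  increase  : ∀ {g} → g < + 0 → Step⁻ g -[1+ 0 ]

data Step⁺ : ℤ → ℤ → Set where
  unchanged : ∀ {g} → Step⁺ g (+ 0)
  decrease  : ∀ {g} → + 0 < g → Step⁺ g (+ 1)
  increase  : ∀ {g} → + 0 ≤ g → Step⁺ g -[1+ 0 ]

Step⁻-neg : ∀ {g d} → Step⁻ (- g) d → Step⁺ g (- d)
Step⁻-neg unchanged        = unchanged
Step⁻-neg (decrease -g≤0) = increase (neg≤0⇒≥0 -g≤0)
Step⁻-neg (increase -g<0) = decrease (neg<0⇒>0 -g<0)

Step⁺-neg : ∀ {g d} → Step⁺ (- g) d → Step⁻ g (- d)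
Step⁺-neg unchanged        = unchanged
Step⁺-neg (decrease -g>0) = increase (neg>0⇒<0 -g>0)
Step⁺-neg (increase -g≥0) = decrease (neg≥0⇒≤0 -g≥0)

Step⁺-parts : ∀ {g d} → Step⁺ g d →
              (posPart g ∸ posPart d) ℕ.+ posPart d ≡ posPart g
              × (posPart g ∸ posPart d) ℕ.+ negPart d ≡ posPart (g - d)
              × negPart (g - d) ≡ negPart g
Step⁺-parts (unchanged {+ m})       = ℕ.+-identityʳ m , refl , refl
Step⁺-parts (unchanged { -[1+ m ]}) = refl , refl , refl
Step⁺-parts (decrease {+ suc m} _)  = ℕ.+-comm m 1 , ℕ.+-identityʳ m , refl
Step⁺-parts (increase {+ m} _)      = ℕ.+-identityʳ m , refl , refl
Step⁺-parts (decrease {+ zero} (ℤ.+<+ ()))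

Step⁻-parts : ∀ {g d} → Step⁻ g d →
              (negPart g ∸ negPart d) ℕ.+ posPart d ≡ negPart (g - d)
              × (negPart g ∸ negPart d) ℕ.+ negPart d ≡ negPart g
              × posPart (g - d) ≡ posPart g
Step⁻-parts (unchanged {+ m})              = refl , refl , ℕ.+-identityʳ m
Step⁻-parts (unchanged { -[1+ m ]})        = ℕ.+-identityʳ (suc m) , ℕ.+-identityʳ (suc m) , refl
Step⁻-parts (decrease {+ zero} _)          = refl , refl , refl
Step⁻-parts (decrease { -[1+ m ]} _)       = cong suc (ℕ.+-suc m 0) , ℕ.+-identityʳ (suc m) , refl
Step⁻-parts (increase { -[1+ zero ]} _)    = refl , refl , refl
Step⁻-parts (increase { -[1+ suc m ]} _)   = ℕ.+-identityʳ (suc m) , ℕ.+-comm (suc m) 1 , refl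
Step⁻-parts (decrease {+ suc m} (ℤ.+≤+ ()))
Step⁻-parts (increase {+ m} (ℤ.+<+ ()))

record Move (Step : ℤ → ℤ → Set) {n k : ℕ} (z : Fin n → Fin k) (γ : ZVec n) : Set where
  field
    δ          : ZVec n
    δ∈M        : InM z δ
    balanced   : sumℤ δ ≡ + 0  -- implied by δ∈M, but immediate for the 4-cycles used here
    steps      : ∀ e → Step (γ e) (δ e)
    alternates : Alternating z (γ -ᵛ δ)

Move-neg : ∀ {S T : ℤ → ℤ → Set} {n k} {z : Fin n → Fin k} {γ : ZVec n} →
           (∀ {g d} → S (- g) d → T g (- d)) → Move S z (-ᵛ γ) → Move T z γ
Move-neg {γ = γ} S⇒T m = record
  { δ          = -ᵛ δ
  ; δ∈M        = InM-neg δ∈M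
  ; balanced   = trans (sumℤ-neg δ) (cong -_ balanced)
  ; steps      = S⇒T ∘ steps
  ; alternates = Alternating-neg (Alternating-cong negated alternates)
  }
  where
  open Move m
  negated : ∀ e → - γ e - δ e ≡ - (γ e - - δ e)
  negated e = sym (trans (ℤ.neg-distrib-+ (γ e) (- - δ e)) (cong (_+_ (- γ e)) (ℤ.neg-involutive (- δ e))))

data Reduction {n k : ℕ} (z : Fin n → Fin k) (γ : ZVec n) : Set where
  alternating : Alternating z γ → Reduction z γ
  move⁻       : Move Step⁻ z γ → Reduction z γ
  move⁺       : Move Step⁺ z γ → Reduction z γ

Reduction-neg : ∀ {n k} {z : Fin n → Fin k} {γ : ZVec n} → Reduction z (-ᵛ γ) → Reduction z γ
Reduction-neg (alternating alt) = alternating (Alternating-neg alt)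
Reduction-neg (move⁻ m)         = move⁺ (Move-neg Step⁻-neg m)
Reduction-neg (move⁺ m)         = move⁻ (Move-neg Step⁺-neg m)

-- Alternating 4-cycles

module FourCycle {n : ℕ} (p₁ p₂ p₃ p₄ : Fin n)
  (p₁≢p₂ : p₁ ≢ p₂) (p₁≢p₃ : p₁ ≢ p₃) (p₁≢p₄ : p₁ ≢ p₄)
  (p₂≢p₃ : p₂ ≢ p₃) (p₂≢p₄ : p₂ ≢ p₄) (p₃≢p₄ : p₃ ≢ p₄) where

  e₁₂ e₂₃ e₃₄ e₄₁ : Edge n
  e₁₂ = edge p₁ p₂ p₁≢p₂
  e₂₃ = edge p₂ p₃ p₂≢p₃
  e₃₄ = edge p₃ p₄ p₃≢p₄
  e₄₁ = edge p₄ p₁ (p₁≢p₄ ∘ sym)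

  δ : ZVec n
  δ e = (𝟙 e₁₂ e + 𝟙 e₃₄ e) - (𝟙 e₂₃ e + 𝟙 e₄₁ e)

  private
    p₁∈e₁₂ : p₁ ∈ᴱ e₁₂
    p₁∈e₁₂ = proj₁ (∈ᴱ-edge p₁ p₂ p₁≢p₂)
    p₂∈e₁₂ : p₂ ∈ᴱ e₁₂
    p₂∈e₁₂ = proj₂ (∈ᴱ-edge p₁ p₂ p₁≢p₂)
    p₂∈e₂₃ : p₂ ∈ᴱ e₂₃
    p₂∈e₂₃ = proj₁ (∈ᴱ-edge p₂ p₃ p₂≢p₃)
    p₃∈e₃₄ : p₃ ∈ᴱ e₃₄
    p₃∈e₃₄ = proj₁ (∈ᴱ-edge p₃ p₄ p₃≢p₄)

    e₁₂≢e₂₃ : e₁₂ ≢ e₂₃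
    e₁₂≢e₂₃ = ∈ᴱ∧∉ᴱ⇒≢ p₁∈e₁₂ (∉ᴱ-edge p₁≢p₂ p₁≢p₃)
    e₁₂≢e₃₄ : e₁₂ ≢ e₃₄
    e₁₂≢e₃₄ = ∈ᴱ∧∉ᴱ⇒≢ p₁∈e₁₂ (∉ᴱ-edge p₁≢p₃ p₁≢p₄)
    e₁₂≢e₄₁ : e₁₂ ≢ e₄₁
    e₁₂≢e₄₁ = ∈ᴱ∧∉ᴱ⇒≢ p₂∈e₁₂ (∉ᴱ-edge p₂≢p₄ (p₁≢p₂ ∘ sym))
    e₂₃≢e₃₄ : e₂₃ ≢ e₃₄
    e₂₃≢e₃₄ = ∈ᴱ∧∉ᴱ⇒≢ p₂∈e₂₃ (∉ᴱ-edge p₂≢p₃ p₂≢p₄)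
    e₂₃≢e₄₁ : e₂₃ ≢ e₄₁
    e₂₃≢e₄₁ = ∈ᴱ∧∉ᴱ⇒≢ p₂∈e₂₃ (∉ᴱ-edge p₂≢p₄ (p₁≢p₂ ∘ sym))
    e₃₄≢e₄₁ : e₃₄ ≢ e₄₁
    e₃₄≢e₄₁ = ∈ᴱ∧∉ᴱ⇒≢ p₃∈e₃₄ (∉ᴱ-edge p₃≢p₄ (p₁≢p₃ ∘ sym))

  cycle-elim : (P : Edge n → ℤ → ℤ → ℤ → ℤ → Set) →
               P e₁₂ (+ 1) (+ 0) (+ 0) (+ 0) → P e₂₃ (+ 0) (+ 1) (+ 0) (+ 0) →
               P e₃₄ (+ 0) (+ 0) (+ 1) (+ 0) → P e₄₁ (+ 0) (+ 0) (+ 0) (+ 1) →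
               (∀ e → e ≢ e₁₂ → e ≢ e₂₃ → e ≢ e₃₄ → e ≢ e₄₁ → P e (+ 0) (+ 0) (+ 0) (+ 0)) →
               ∀ e → P e (𝟙 e₁₂ e) (𝟙 e₂₃ e) (𝟙 e₃₄ e) (𝟙 e₄₁ e)
  cycle-elim P P₁₂ P₂₃ P₃₄ P₄₁ Poff e with e ≟ᴱ e₁₂
  ... | yes refl rewrite 𝟙-other e₁₂≢e₂₃ | 𝟙-other e₁₂≢e₃₄ | 𝟙-other e₁₂≢e₄₁ = P₁₂
  ... | no e≢e₁₂ with e ≟ᴱ e₂₃
  ...   | yes refl rewrite 𝟙-other e₂₃≢e₃₄ | 𝟙-other e₂₃≢e₄₁ = P₂₃
  ...   | no e≢e₂₃ with e ≟ᴱ e₃₄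
  ...     | yes refl rewrite 𝟙-other e₃₄≢e₄₁ = P₃₄
  ...     | no e≢e₃₄ with e ≟ᴱ e₄₁
  ...       | yes refl = P₄₁
  ...       | no e≢e₄₁ = Poff e e≢e₁₂ e≢e₂₃ e≢e₃₄ e≢e₄₁

  δ-row : (R : Edge n → Bool) →
          sumℤ (restrict R δ) ≡ (fromBool (R e₁₂) + fromBool (R e₃₄)) - (fromBool (R e₂₃) + fromBool (R e₄₁))
  δ-row R = begin
    sumℤ (restrict R δ)                                      ≡⟨ ∑-cong (allEdges n) restrict-δ ⟩
    ∑ (allEdges n) (λ e → (r e₁₂ e + r e₃₄ e) - (r e₂₃ e + r e₄₁ e))
      ≡⟨ ∑-- (allEdges n) (λ e → r e₁₂ e + r e₃₄ e) (λ e → r e₂₃ e + r e₄₁ e) ⟩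
    ∑ (allEdges n) (λ e → r e₁₂ e + r e₃₄ e) - ∑ (allEdges n) (λ e → r e₂₃ e + r e₄₁ e)
      ≡⟨ cong₂ _-_ (∑-+ (allEdges n) (r e₁₂) (r e₃₄)) (∑-+ (allEdges n) (r e₂₃) (r e₄₁)) ⟩
    (sumℤ (r e₁₂) + sumℤ (r e₃₄)) - (sumℤ (r e₂₃) + sumℤ (r e₄₁))
      ≡⟨ cong₂ _-_ (cong₂ _+_ (∑-restrict-𝟙 R e₁₂) (∑-restrict-𝟙 R e₃₄))
                   (cong₂ _+_ (∑-restrict-𝟙 R e₂₃) (∑-restrict-𝟙 R e₄₁)) ⟩
    (fromBool (R e₁₂) + fromBool (R e₃₄)) - (fromBool (R e₂₃) + fromBool (R e₄₁)) ∎
    where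
    open ≡-Reasoning
    r : Edge n → ZVec n
    r e = restrict R (𝟙 e)
    restrict-δ : ∀ e → restrict R δ e ≡ (r e₁₂ e + r e₃₄ e) - (r e₂₃ e + r e₄₁ e)
    restrict-δ e with R e
    ... | true  = refl
    ... | false = refl

  δ-balanced : sumℤ δ ≡ + 0
  δ-balanced = δ-row (λ _ → true)

  δ∈ker : ∀ {k} {z : Fin n → Fin k} → z p₂ ≡ z p₄ → InKer z δ
  δ∈ker {z = z} zp₂≡zp₄ = record
    { vertexRows = λ w → trans (δ-row (incident w)) (vertex-cancels w)
    ; colourRows = λ i j _ → trans (δ-row (colourRow z i j)) (colour-cancels i j)
    }
    where
    vertex-cancels : ∀ w → (fromBool (incident w e₁₂) + fromBool (incident w e₃₄))
                             - (fromBool (incident w e₂₃) + fromBool (incident w e₄₁)) ≡ + 0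
    vertex-cancels w
      rewrite fromBool-incident w p₁ p₂ p₁≢p₂ | fromBool-incident w p₃ p₄ p₃≢p₄
            | fromBool-incident w p₂ p₃ p₂≢p₃ | fromBool-incident w p₄ p₁ (p₁≢p₄ ∘ sym)
      = cycle-cancels (fromBool ⌊ w F.≟ p₁ ⌋) (fromBool ⌊ w F.≟ p₂ ⌋)
                      (fromBool ⌊ w F.≟ p₃ ⌋) (fromBool ⌊ w F.≟ p₄ ⌋)
      where
      cycle-cancels : ∀ a b c d → ((a + b) + (c + d)) - ((b + c) + (d + a)) ≡ + 0
      cycle-cancels = solve-∀
    colour-cancels : ∀ i j → (fromBool (colourRow z i j e₁₂) + fromBool (colourRow z i j e₃₄))
                               - (fromBool (colourRow z i j e₂₃) + fromBool (colourRow z i j e₄₁)) ≡ + 0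
    colour-cancels i j
      rewrite colourRow-edge z i j p₁ p₂ p₁≢p₂ | colourRow-edge z i j p₃ p₄ p₃≢p₄
            | colourRow-edge z i j p₂ p₃ p₂≢p₃ | colourRow-edge z i j p₄ p₁ (p₁≢p₄ ∘ sym)
            | zp₂≡zp₄ | inColourRow-comm i j (z p₃) (z p₄) | inColourRow-comm i j (z p₄) (z p₁)
      = swap-cancels (fromBool (inColourRow i j (z p₁) (z p₄))) (fromBool (inColourRow i j (z p₄) (z p₃)))
      where
      swap-cancels : ∀ x y → (x + y) - (y + x) ≡ + 0
      swap-cancels = solve-∀

  ‖δ‖≡4 : norm1 δ ≡ 4
  ‖δ‖≡4 = ℤ.+-injective (begin
    + norm1 δ                                                       ≡⟨ pos-∑ (allEdges n) (λ e → ℤ.∣ δ e ∣) ⟩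
    ∑ (allEdges n) (λ e → + ℤ.∣ δ e ∣)                              ≡⟨ ∑-cong (allEdges n) ∣δ∣ ⟩
    ∑ (allEdges n) (λ e → (𝟙 e₁₂ e + 𝟙 e₃₄ e) + (𝟙 e₂₃ e + 𝟙 e₄₁ e))
      ≡⟨ trans (∑-+ (allEdges n) (λ e → 𝟙 e₁₂ e + 𝟙 e₃₄ e) (λ e → 𝟙 e₂₃ e + 𝟙 e₄₁ e))
               (cong₂ _+_ (∑-+ (allEdges n) (𝟙 e₁₂) (𝟙 e₃₄)) (∑-+ (allEdges n) (𝟙 e₂₃) (𝟙 e₄₁))) ⟩
    (sumℤ (𝟙 e₁₂) + sumℤ (𝟙 e₃₄)) + (sumℤ (𝟙 e₂₃) + sumℤ (𝟙 e₄₁))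
      ≡⟨ cong₂ _+_ (cong₂ _+_ (∑-𝟙 e₁₂) (∑-𝟙 e₃₄)) (cong₂ _+_ (∑-𝟙 e₂₃) (∑-𝟙 e₄₁)) ⟩
    + 4                                                             ∎)
    where
    open ≡-Reasoning
    ∑-𝟙 : ∀ e → sumℤ (𝟙 e) ≡ + 1
    ∑-𝟙 = ∑-restrict-𝟙 (λ _ → true)
    ∣δ∣ : ∀ e → + ℤ.∣ δ e ∣ ≡ (𝟙 e₁₂ e + 𝟙 e₃₄ e) + (𝟙 e₂₃ e + 𝟙 e₄₁ e)
    ∣δ∣ = cycle-elim (λ _ a b c d → + ℤ.∣ (a + c) - (b + d) ∣ ≡ (a + c) + (b + d))
                     refl refl refl refl (λ _ _ _ _ _ → refl)

  δ∈M : ∀ {k} {z : Fin n → Fin k} → z p₂ ≡ z p₄ → InM z δ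
  δ∈M zp₂≡zp₄ = δ∈ker zp₂≡zp₄ , ‖δ‖≡4

  steps⁻ : (γ : ZVec n) → entry γ p₁ p₂ ≤ + 0 → entry γ p₃ p₄ ≤ + 0 →
           entry γ p₂ p₃ < + 0 → entry γ p₄ p₁ < + 0 →
           ∀ e → Step⁻ (γ e) (δ e)
  steps⁻ γ γ₁₂≤0 γ₃₄≤0 γ₂₃<0 γ₄₁<0 = cycle-elim (λ e a b c d → Step⁻ (γ e) ((a + c) - (b + d)))
    (decrease (subst (_≤ + 0) (entry-edge γ p₁ p₂ _) γ₁₂≤0))
    (increase (subst (_< + 0) (entry-edge γ p₂ p₃ _) γ₂₃<0))
    (decrease (subst (_≤ + 0) (entry-edge γ p₃ p₄ _) γ₃₄≤0))
    (increase (subst (_< + 0) (entry-edge γ p₄ p₁ _) γ₄₁<0))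
    (λ _ _ _ _ _ → unchanged)

  δ-e₁₂ : δ e₁₂ ≡ + 1
  δ-e₁₂ = cong₂ _-_ (cong₂ _+_ (𝟙-same e₁₂) (𝟙-other e₁₂≢e₃₄))
                    (cong₂ _+_ (𝟙-other e₁₂≢e₂₃) (𝟙-other e₁₂≢e₄₁))

  δ-off : {u : Fin n} {e : Edge n} → u ≢ p₁ → u ≢ p₂ → u ≢ p₃ → u ≢ p₄ → u ∈ᴱ e → δ e ≡ + 0
  δ-off {u} {e} u≢p₁ u≢p₂ u≢p₃ u≢p₄ u∈e =
    cong₂ _-_ (cong₂ _+_ (off u≢p₁ u≢p₂) (off u≢p₃ u≢p₄))
              (cong₂ _+_ (off u≢p₂ u≢p₃) (off u≢p₄ u≢p₁))
    where
    off : ∀ {p q} .{p≢q : p ≢ q} → u ≢ p → u ≢ q → 𝟙 (edge p q p≢q) e ≡ + 0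
    off u≢p u≢q = 𝟙-other (∈ᴱ∧∉ᴱ⇒≢ u∈e (∉ᴱ-edge u≢p u≢q))

  entry-δ-off : {u : Fin n} → u ≢ p₁ → u ≢ p₂ → u ≢ p₃ → u ≢ p₄ →
                (q : Fin n) → u ≢ q → entry δ u q ≡ + 0
  entry-δ-off {u} u≢p₁ u≢p₂ u≢p₃ u≢p₄ q u≢q =
    trans (entry-edge δ u q u≢q) (δ-off u≢p₁ u≢p₂ u≢p₃ u≢p₄ (proj₁ (∈ᴱ-edge u q u≢q)))

  entry-δ-p₂p₁ : entry δ p₂ p₁ ≡ + 1
  entry-δ-p₂p₁ = trans (entry-comm δ p₂ p₁) (trans (entry-edge δ p₁ p₂ p₁≢p₂) δ-e₁₂)

module _ {n k : ℕ} {z : Fin n → Fin k} where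

  cycle-move⁻ : {γ : ZVec n} (u v w x y : Fin n) → + 0 < entry γ u v → entry γ v w < + 0 → entry γ x y < + 0 →
               z x ≡ z u → z y ≡ z v → z u ≢ z w → x ≢ u → x ≢ v → y ≢ u → y ≢ v → y ≢ w →
               entry γ x v ≤ + 0 → entry γ w y ≤ + 0 → Move Step⁻ z γ
  cycle-move⁻ {γ} u v w x y uv>0 vw<0 xy<0 zx≡zu zy≡zv zu≢zw x≢u x≢v y≢u y≢v y≢w xv≤0 wy≤0 = record
    { δ          = δ
    ; δ∈M        = δ∈M (sym zy≡zv)
    ; balanced   = δ-balanced
    ; steps      = steps⁻ γ xv≤0 wy≤0 vw<0 (entry<0-comm γ x y xy<0)
    ; alternates = u , v , x , sym zx≡zu , inj₁ (uv>0′ , vx<0′)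
    }
    where
    x≢w : x ≢ w
    x≢w x≡w = zu≢zw (trans (sym zx≡zu) (cong z x≡w))
    open FourCycle x v w y x≢v x≢w (entry<0⇒≢ γ xy<0) (entry<0⇒≢ γ vw<0) (y≢v ∘ sym) (y≢w ∘ sym)
    open ≡-Reasoning
    uv>0′ : + 0 < entry (γ -ᵛ δ) u v
    uv>0′ = subst (+ 0 <_) (sym (begin
      entry (γ -ᵛ δ) u v         ≡⟨ entry-- γ δ u v ⟩
      entry γ u v - entry δ u v  ≡⟨ cong (_-_ (entry γ u v))
                                      (entry-δ-off (x≢u ∘ sym) (entry>0⇒≢ γ uv>0) (zu≢zw ∘ cong z) (y≢u ∘ sym)
                                                   v (entry>0⇒≢ γ uv>0)) ⟩
      entry γ u v - + 0          ≡⟨ ℤ.+-identityʳ _ ⟩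
      entry γ u v                ∎)) uv>0
    vx<0′ : entry (γ -ᵛ δ) v x < + 0
    vx<0′ = subst (_< + 0) (sym (trans (entry-- γ δ v x) (cong (_-_ (entry γ v x)) entry-δ-p₂p₁)))
                  (≤0⇒-1<0 (entry≤0-comm γ x v xv≤0))

  colour-row-step : {γ : ZVec n} → InKer z γ → (u v w : Fin n) → + 0 < entry γ u v → entry γ v w < + 0 →
                z u ≢ z w → z v ≡ z w ⊎ Reduction z γ
  colour-row-step {γ} γ∈ker u v w uv>0 vw<0 zu≢zw = partner-step (colour-partner γ∈ker u v uv>0)
    where
    partner-step : (∃ λ x → ∃ λ y → z x ≡ z u × z y ≡ z v × entry γ x y < + 0) → z v ≡ z w ⊎ Reduction z γ
    partner-step (x , y , zx≡zu , zy≡zv , xy<0) with x F.≟ v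
    ... | yes refl = inj₂ (alternating (u , x , y , sym (trans zy≡zv zx≡zu) , inj₁ (uv>0 , xy<0)))
    ... | no x≢v with y F.≟ v
    ... | yes refl = inj₂ (alternating (u , y , x , sym zx≡zu , inj₁ (uv>0 , entry<0-comm γ x y xy<0)))
    ... | no y≢v with x F.≟ u
    ... | yes refl = inj₂ (alternating (v , x , y , sym zy≡zv , inj₁ (entry>0-comm γ x v uv>0 , xy<0)))
    ... | no x≢u with y F.≟ u
    ... | yes refl = inj₂ (alternating (v , y , x , trans (sym zy≡zv) (sym zx≡zu) ,
                                        inj₁ (entry>0-comm γ y v uv>0 , entry<0-comm γ x y xy<0)))
    ... | no y≢u with y F.≟ w
    ... | yes refl = inj₁ (sym zy≡zv)
    ... | no y≢w with + 0 ℤ.<? entry γ x v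
    ... | yes xv>0 = inj₂ (alternating (y , x , v , zy≡zv , inj₂ (entry<0-comm γ x y xy<0 , xv>0)))
    ... | no xv≯0 with + 0 ℤ.<? entry γ w y
    ... | yes wy>0 = inj₂ (alternating (v , w , y , sym zy≡zv , inj₂ (vw<0 , wy>0)))
    ... | no wy≯0 = inj₂ (move⁻ (cycle-move⁻ u v w x y uv>0 vw<0 xy<0 zx≡zu zy≡zv zu≢zw x≢u x≢v y≢u y≢v y≢w
                                             (ℤ.≮⇒≥ xv≯0) (ℤ.≮⇒≥ wy≯0)))

  wedge-reduction : {γ : ZVec n} → InKer z γ → (u v w : Fin n) → + 0 < entry γ u v → entry γ v w < + 0 →
                    Reduction z γ
  wedge-reduction {γ} γ∈ker u v w uv>0 vw<0 with z u F.≟ z w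
  ... | yes zu≡zw = alternating (u , v , w , zu≡zw , inj₁ (uv>0 , vw<0))
  ... | no zu≢zw  = [ reversed , id ]′ (colour-row-step γ∈ker u v w uv>0 vw<0 zu≢zw)
    where
    -- Now z v = z w ≠ z u, so the colour-row step for −γ along w, v, u cannot fail in the same way.
    reversed : z v ≡ z w → Reduction z γ
    reversed zv≡zw = [ (λ zv≡zu → contradiction (trans (sym zv≡zu) zv≡zw) zu≢zw) , Reduction-neg ]′
      (colour-row-step (InKer-neg γ∈ker) w v u wv>0 vu<0 (zu≢zw ∘ sym))
      where
      wv>0 : + 0 < entry (-ᵛ γ) w v
      wv>0 = subst (+ 0 <_) (sym (entry-neg γ w v)) (ℤ.neg-mono-< (entry<0-comm γ v w vw<0))
      vu<0 : entry (-ᵛ γ) v u < + 0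
      vu<0 = subst (_< + 0) (sym (entry-neg γ v u)) (ℤ.neg-mono-< (entry>0-comm γ u v uv>0))

  edge-reduction : {γ : ZVec n} → InKer z γ → (e : Edge n) → + 0 < γ e → Reduction z γ
  edge-reduction {γ} γ∈ker (a , b , a<b) γe>0 = wedge-reduction γ∈ker a b w ab>0 bw<0
    where
    ab>0 : + 0 < entry γ a b
    ab>0 = subst (+ 0 <_) (sym (entry-< γ a<b)) γe>0
    w : Fin n
    w = proj₁ (vertex-partner γ∈ker a b ab>0)
    bw<0 : entry γ b w < + 0
    bw<0 = proj₂ (vertex-partner γ∈ker a b ab>0)

  nonzero-edge : {γ : ZVec n} → ¬ (∀ e → γ e ≡ + 0) → ∃ λ e → γ e ≢ + 0
  nonzero-edge {γ} γ≢0 with all? (λ e → γ e ℤ.≟ + 0) (allEdges n)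
  ... | yes all≡0 = contradiction (λ e → All.lookup all≡0 (∈-allEdges e)) γ≢0
  ... | no ¬all≡0 = Any.satisfied (¬All⇒Any¬ (λ e → γ e ℤ.≟ + 0) (allEdges n) ¬all≡0)

  reduction : {γ : ZVec n} → InKer z γ → ¬ (∀ e → γ e ≡ + 0) → Reduction z γ
  reduction {γ} γ∈ker γ≢0 = by-sign (nonzero-edge γ≢0)
    where
    by-sign : (∃ λ e → γ e ≢ + 0) → Reduction z γ
    by-sign (e , γe≢0) with ℤ.<-cmp (+ 0) (γ e)
    ... | tri< γe>0 _ _ = edge-reduction γ∈ker e γe>0
    ... | tri≈ _ 0≡γe _ = contradiction (sym 0≡γe) γe≢0
    ... | tri> _ _ γe<0 = Reduction-neg (edge-reduction (InKer-neg γ∈ker) e (ℤ.neg-mono-< γe<0))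

module BinomialCalculus {c ℓ : Level} (K : CommutativeRing c ℓ) (n : ℕ) where
  open CommutativeRing K renaming (refl to ≈-refl; sym to ≈-sym; trans to ≈-trans; reflexive to ≈-reflexive;
                                   _+_ to _+ᴷ_; _*_ to _*ᴷ_; -_ to -ᴷ_; _-_ to _-ᴷ_)
  open Poly K n
  open import Relation.Binary.Reasoning.Setoid setoid

  _·ᵐ_ : Mono n → Mono n → Mono n
  (α ·ᵐ β) e = α e ℕ.+ β e

  monomial·binom : Mono n → ZVec n → Pol
  monomial·binom m δ = combo ((monomial m , δ) ∷ [])

  ⟦_≟_⟧ : Mono n → Mono n → Carrier
  ⟦ α ≟ χ ⟧ = if sameMono α χ then 1# else 0#

  ⟦⟧-cong : {α α′ : Mono n} → (∀ e → α e ≡ α′ e) → (χ : Mono n) → ⟦ α ≟ χ ⟧ ≈ ⟦ α′ ≟ χ ⟧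
  ⟦⟧-cong {α} {α′} α≗α′ χ =
    ≈-reflexive (cong (if_then 1# else 0#)
      (foldr-cong (λ e b → cong (λ k → ⌊ k ℕ.≟ χ e ⌋ ∧ b) (α≗α′ e)) refl (allEdges n)))

  coeff-∷ : (a : Carrier) (α : Mono n) (p : Pol) (χ : Mono n) →
            coeff ((a , α) ∷ p) χ ≈ a *ᴷ ⟦ α ≟ χ ⟧ +ᴷ coeff p χ
  coeff-∷ a α p χ with sameMono α χ
  ... | true  = +-congʳ (≈-sym (*-identityʳ a))
  ... | false = ≈-sym (≈-trans (+-congʳ (zeroʳ a)) (+-identityˡ _))

  coeff-++ : (p q : Pol) (χ : Mono n) → coeff (p ++ q) χ ≈ coeff p χ +ᴷ coeff q χ
  coeff-++ []            q χ = ≈-sym (+-identityˡ _)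
  coeff-++ ((a , α) ∷ p) q χ = begin
    coeff ((a , α) ∷ p ++ q) χ               ≈⟨ coeff-∷ a α (p ++ q) χ ⟩
    a *ᴷ ⟦ α ≟ χ ⟧ +ᴷ coeff (p ++ q) χ          ≈⟨ +-congˡ (coeff-++ p q χ) ⟩
    a *ᴷ ⟦ α ≟ χ ⟧ +ᴷ (coeff p χ +ᴷ coeff q χ)   ≈⟨ ≈-sym (+-assoc _ _ _) ⟩
    (a *ᴷ ⟦ α ≟ χ ⟧ +ᴷ coeff p χ) +ᴷ coeff q χ   ≈⟨ +-congʳ (≈-sym (coeff-∷ a α p χ)) ⟩
    coeff ((a , α) ∷ p) χ +ᴷ coeff q χ         ∎

  coeff-binomial : {a b : Carrier} → a ≈ 1# → b ≈ -ᴷ 1# → (α β χ : Mono n) →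
                   coeff ((a , α) ∷ (b , β) ∷ []) χ ≈ ⟦ α ≟ χ ⟧ -ᴷ ⟦ β ≟ χ ⟧
  coeff-binomial {a} {b} a≈1 b≈-1 α β χ = begin
    coeff ((a , α) ∷ (b , β) ∷ []) χ           ≈⟨ coeff-∷ a α ((b , β) ∷ []) χ ⟩
    a *ᴷ ⟦ α ≟ χ ⟧ +ᴷ coeff ((b , β) ∷ []) χ     ≈⟨ +-congˡ (coeff-∷ b β [] χ) ⟩
    a *ᴷ ⟦ α ≟ χ ⟧ +ᴷ (b *ᴷ ⟦ β ≟ χ ⟧ +ᴷ 0#)        ≈⟨ +-cong (≈-trans (*-congʳ a≈1) (*-identityˡ _))
                                                          (≈-trans (+-identityʳ _) (*-congʳ b≈-1)) ⟩
    ⟦ α ≟ χ ⟧ +ᴷ -ᴷ 1# *ᴷ ⟦ β ≟ χ ⟧                ≈⟨ +-congˡ (-1*x≈-x _) ⟩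
    ⟦ α ≟ χ ⟧ -ᴷ ⟦ β ≟ χ ⟧                       ∎
    where open import Algebra.Properties.Ring ring using (-1*x≈-x)

  -ᴷ-cong : {x x′ y y′ : Carrier} → x ≈ x′ → y ≈ y′ → x -ᴷ y ≈ x′ -ᴷ y′
  -ᴷ-cong x≈x′ y≈y′ = +-cong x≈x′ (-‿cong y≈y′)

  telescope : (x y w : Carrier) → (x -ᴷ y) +ᴷ (y -ᴷ w) ≈ x -ᴷ w
  telescope x y w = begin
    (x -ᴷ y) +ᴷ (y -ᴷ w)      ≈⟨ +-assoc x (-ᴷ y) (y -ᴷ w) ⟩
    x +ᴷ (-ᴷ y +ᴷ (y -ᴷ w))    ≈⟨ +-congˡ (≈-sym (+-assoc (-ᴷ y) y (-ᴷ w))) ⟩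
    x +ᴷ ((-ᴷ y +ᴷ y) -ᴷ w)    ≈⟨ +-congˡ (+-congʳ (-‿inverseˡ y)) ⟩
    x +ᴷ (0# -ᴷ w)           ≈⟨ +-congˡ (+-identityˡ (-ᴷ w)) ⟩
    x -ᴷ w                  ∎

  coeff-binom : (γ : ZVec n) (χ : Mono n) → coeff (binom γ) χ ≈ ⟦ γ ⁺ ≟ χ ⟧ -ᴷ ⟦ γ ⁻ ≟ χ ⟧
  coeff-binom γ = coeff-binomial ≈-refl ≈-refl (γ ⁺) (γ ⁻)

  coeff-monomial·binom : (m : Mono n) (δ : ZVec n) (χ : Mono n) →
                         coeff (monomial·binom m δ) χ ≈ ⟦ m ·ᵐ (δ ⁺) ≟ χ ⟧ -ᴷ ⟦ m ·ᵐ (δ ⁻) ≟ χ ⟧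
  coeff-monomial·binom m δ = coeff-binomial (*-identityˡ 1#) (*-identityˡ (-ᴷ 1#)) _ _

  binom∈ideal : (S : ZVec n → Set) {γ : ZVec n} → S γ → InBinomialIdeal S (binom γ)
  binom∈ideal S {γ} Sγ =
    ((1P , γ) ∷ []) , Sγ ∷ [] , λ χ → ≈-trans (coeff-binom γ χ) (≈-sym (coeff-monomial·binom (λ _ → 0) γ χ))

  monomial·binom∈ideal : (S : ZVec n → Set) (m : Mono n) {δ : ZVec n} → S δ →
                         InBinomialIdeal S (monomial·binom m δ)
  monomial·binom∈ideal S m {δ} Sδ = ((monomial m , δ) ∷ []) , Sδ ∷ [] , λ _ → ≈-refl

  ≈P-refl : {p : Pol} → p ≈P p
  ≈P-refl _ = ≈-refl

  []∈ideal : (S : ZVec n → Set) → InBinomialIdeal S []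
  []∈ideal S = [] , [] , λ _ → ≈-refl

  coeff-monomial·binom+binom : (m : Mono n) (δ γ″ : ZVec n) (χ : Mono n) →
    coeff (monomial·binom m δ +P binom γ″) χ
      ≈ (⟦ m ·ᵐ (δ ⁺) ≟ χ ⟧ -ᴷ ⟦ m ·ᵐ (δ ⁻) ≟ χ ⟧) +ᴷ (⟦ γ″ ⁺ ≟ χ ⟧ -ᴷ ⟦ γ″ ⁻ ≟ χ ⟧)
  coeff-monomial·binom+binom m δ γ″ χ =
    ≈-trans (coeff-++ (monomial·binom m δ) (binom γ″) χ) (+-cong (coeff-monomial·binom m δ χ) (coeff-binom γ″ χ))

  decompose⁺ : (γ δ γ″ : ZVec n) (m : Mono n) →
               (∀ e → m e ℕ.+ posPart (δ e) ≡ posPart (γ e)) →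
               (∀ e → m e ℕ.+ negPart (δ e) ≡ posPart (γ″ e)) →
               (∀ e → negPart (γ″ e) ≡ negPart (γ e)) →
               binom γ ≈P (monomial·binom m δ +P binom γ″)
  decompose⁺ γ δ γ″ m m·δ⁺≡γ⁺ m·δ⁻≡γ″⁺ γ″⁻≡γ⁻ χ = begin
    coeff (binom γ) χ                                               ≈⟨ coeff-binom γ χ ⟩
    ⟦ γ ⁺ ≟ χ ⟧ -ᴷ ⟦ γ ⁻ ≟ χ ⟧                                       ≈⟨ telescope _ ⟦ γ″ ⁺ ≟ χ ⟧ _ ⟨
    (⟦ γ ⁺ ≟ χ ⟧ -ᴷ ⟦ γ″ ⁺ ≟ χ ⟧) +ᴷ (⟦ γ″ ⁺ ≟ χ ⟧ -ᴷ ⟦ γ ⁻ ≟ χ ⟧)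
      ≈⟨ +-cong (-ᴷ-cong (⟦⟧-cong (sym ∘ m·δ⁺≡γ⁺) χ) (⟦⟧-cong (sym ∘ m·δ⁻≡γ″⁺) χ))
                (-ᴷ-cong ≈-refl (⟦⟧-cong (sym ∘ γ″⁻≡γ⁻) χ)) ⟩
    (⟦ m ·ᵐ (δ ⁺) ≟ χ ⟧ -ᴷ ⟦ m ·ᵐ (δ ⁻) ≟ χ ⟧) +ᴷ (⟦ γ″ ⁺ ≟ χ ⟧ -ᴷ ⟦ γ″ ⁻ ≟ χ ⟧)
                                                                    ≈⟨ coeff-monomial·binom+binom m δ γ″ χ ⟨
    coeff (monomial·binom m δ +P binom γ″) χ                        ∎

  decompose⁻ : (γ δ γ″ : ZVec n) (m : Mono n) →
               (∀ e → m e ℕ.+ posPart (δ e) ≡ negPart (γ″ e)) →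
               (∀ e → m e ℕ.+ negPart (δ e) ≡ negPart (γ e)) →
               (∀ e → posPart (γ″ e) ≡ posPart (γ e)) →
               binom γ ≈P (monomial·binom m δ +P binom γ″)
  decompose⁻ γ δ γ″ m m·δ⁺≡γ″⁻ m·δ⁻≡γ⁻ γ″⁺≡γ⁺ χ = begin
    coeff (binom γ) χ                                               ≈⟨ coeff-binom γ χ ⟩
    ⟦ γ ⁺ ≟ χ ⟧ -ᴷ ⟦ γ ⁻ ≟ χ ⟧                                       ≈⟨ telescope _ ⟦ γ″ ⁻ ≟ χ ⟧ _ ⟨
    (⟦ γ ⁺ ≟ χ ⟧ -ᴷ ⟦ γ″ ⁻ ≟ χ ⟧) +ᴷ (⟦ γ″ ⁻ ≟ χ ⟧ -ᴷ ⟦ γ ⁻ ≟ χ ⟧)    ≈⟨ +-comm _ _ ⟩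
    (⟦ γ″ ⁻ ≟ χ ⟧ -ᴷ ⟦ γ ⁻ ≟ χ ⟧) +ᴷ (⟦ γ ⁺ ≟ χ ⟧ -ᴷ ⟦ γ″ ⁻ ≟ χ ⟧)
      ≈⟨ +-cong (-ᴷ-cong (⟦⟧-cong (sym ∘ m·δ⁺≡γ″⁻) χ) (⟦⟧-cong (sym ∘ m·δ⁻≡γ⁻) χ))
                (-ᴷ-cong (⟦⟧-cong (sym ∘ γ″⁺≡γ⁺) χ) ≈-refl) ⟩
    (⟦ m ·ᵐ (δ ⁺) ≟ χ ⟧ -ᴷ ⟦ m ·ᵐ (δ ⁻) ≟ χ ⟧) +ᴷ (⟦ γ″ ⁺ ≟ χ ⟧ -ᴷ ⟦ γ″ ⁻ ≟ χ ⟧)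
                                                                    ≈⟨ coeff-monomial·binom+binom m δ γ″ χ ⟨
    coeff (monomial·binom m δ +P binom γ″) χ                        ∎

module _ {n : ℕ} where

  sumℕ-cong : {f g : Edge n → ℕ} → (∀ e → f e ≡ g e) → sumℕ f ≡ sumℕ g
  sumℕ-cong f≗g = foldr-cong (λ e acc → cong (ℕ._+ acc) (f≗g e)) refl (allEdges n)

  pos-sumℕ⁺ : (γ : ZVec n) → + sumℕ (γ ⁺) ≡ sumℤ γ + + sumℕ (γ ⁻)
  pos-sumℕ⁺ γ = begin
    + sumℕ (γ ⁺)                                       ≡⟨ pos-∑ (allEdges n) (γ ⁺) ⟩
    ∑ (allEdges n) (λ e → + posPart (γ e))             ≡⟨ ∑-cong (allEdges n) (λ e → pos≡ (γ e)) ⟩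
    ∑ (allEdges n) (λ e → γ e + + negPart (γ e))       ≡⟨ ∑-+ (allEdges n) γ (λ e → + negPart (γ e)) ⟩
    sumℤ γ + ∑ (allEdges n) (λ e → + negPart (γ e))    ≡⟨ cong (_+_ (sumℤ γ)) (sym (pos-∑ (allEdges n) (γ ⁻))) ⟩
    sumℤ γ + + sumℕ (γ ⁻)                              ∎
    where
    open ≡-Reasoning
    pos≡ : ∀ g → + posPart g ≡ g + + negPart g
    pos≡ (+ m)      = cong +_ (sym (ℕ.+-identityʳ m))
    pos≡ -[1+ m ]   = sym (ℤ.n⊖n≡0 (suc m))

  sumℕ⁺-sub : {γ δ : ZVec n} → sumℤ δ ≡ + 0 → (∀ e → negPart (γ e - δ e) ≡ negPart (γ e)) →
               sumℕ ((γ -ᵛ δ) ⁺) ≡ sumℕ (γ ⁺)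
  sumℕ⁺-sub {γ} {δ} ∑δ≡0 neg≡ = ℤ.+-injective (begin
    + sumℕ ((γ -ᵛ δ) ⁺)                      ≡⟨ pos-sumℕ⁺ (γ -ᵛ δ) ⟩
    sumℤ (γ -ᵛ δ) + + sumℕ ((γ -ᵛ δ) ⁻)      ≡⟨ cong₂ _+_ (∑-- (allEdges n) γ δ) (cong +_ (sumℕ-cong neg≡)) ⟩
    (sumℤ γ - sumℤ δ) + + sumℕ (γ ⁻)         ≡⟨ cong (λ s → (sumℤ γ - s) + + sumℕ (γ ⁻)) ∑δ≡0 ⟩
    (sumℤ γ - + 0) + + sumℕ (γ ⁻)            ≡⟨ cong (_+ + sumℕ (γ ⁻)) (ℤ.+-identityʳ (sumℤ γ)) ⟩
    sumℤ γ + + sumℕ (γ ⁻)                    ≡⟨ sym (pos-sumℕ⁺ γ) ⟩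
    + sumℕ (γ ⁺)                             ∎)
    where open ≡-Reasoning

module _ {c ℓ : Level} (K : CommutativeRing c ℓ) {n k : ℕ} (z : Fin n → Fin k) where
  open Poly K n
  open BinomialCalculus K n

  Decomposition : ZVec n → Set (c ⊔ ℓ)
  Decomposition γ = ∃ λ (f′ : Pol) → ∃ λ (f″ : Pol) → ∃ λ (γ″ : ZVec n) →
    InBinomialIdeal (InM z) f′ × InBinomialIdeal (InKer z) f″ × InKer z γ″ × f″ ≡ binom γ″
    × degBinom γ″ ≡ degBinom γ × (binom γ ≈P (f′ +P f″)) × Alternating z γ″

  decomposition : {γ : ZVec n} → InKer z γ → Reduction z γ → Decomposition γ
  decomposition {γ} γ∈ker (alternating alt) =
    [] , binom γ , γ ,
    []∈ideal (InM z) , binom∈ideal (InKer z) γ∈ker , γ∈ker , refl , refl , ≈P-refl {binom γ} , alt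
  decomposition {γ} γ∈ker (move⁺ m) =
    monomial·binom μ δ , binom (γ -ᵛ δ) , γ -ᵛ δ ,
    monomial·binom∈ideal (InM z) μ δ∈M , binom∈ideal (InKer z) γ″∈ker , γ″∈ker , refl ,
    sumℕ⁺-sub balanced γ″⁻≡γ⁻ ,
    decompose⁺ γ δ (γ -ᵛ δ) μ μ·δ⁺≡γ⁺ μ·δ⁻≡γ″⁺ γ″⁻≡γ⁻ ,
    alternates
    where
    open Move m
    γ″∈ker : InKer z (γ -ᵛ δ)
    γ″∈ker = InKer-- γ∈ker (proj₁ δ∈M)
    μ : Mono n
    μ e = posPart (γ e) ∸ posPart (δ e)
    μ·δ⁺≡γ⁺ : ∀ e → μ e ℕ.+ posPart (δ e) ≡ posPart (γ e)
    μ·δ⁺≡γ⁺ e = proj₁ (Step⁺-parts (steps e))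
    μ·δ⁻≡γ″⁺ : ∀ e → μ e ℕ.+ negPart (δ e) ≡ posPart (γ e - δ e)
    μ·δ⁻≡γ″⁺ e = proj₁ (proj₂ (Step⁺-parts (steps e)))
    γ″⁻≡γ⁻ : ∀ e → negPart (γ e - δ e) ≡ negPart (γ e)
    γ″⁻≡γ⁻ e = proj₂ (proj₂ (Step⁺-parts (steps e)))
  decomposition {γ} γ∈ker (move⁻ m) =
    monomial·binom μ δ , binom (γ -ᵛ δ) , γ -ᵛ δ ,
    monomial·binom∈ideal (InM z) μ δ∈M , binom∈ideal (InKer z) γ″∈ker , γ″∈ker , refl ,
    sumℕ-cong γ″⁺≡γ⁺ ,
    decompose⁻ γ δ (γ -ᵛ δ) μ μ·δ⁺≡γ″⁻ μ·δ⁻≡γ⁻ γ″⁺≡γ⁺ ,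
    alternates
    where
    open Move m
    γ″∈ker : InKer z (γ -ᵛ δ)
    γ″∈ker = InKer-- γ∈ker (proj₁ δ∈M)
    μ : Mono n
    μ e = negPart (γ e) ∸ negPart (δ e)
    μ·δ⁺≡γ″⁻ : ∀ e → μ e ℕ.+ posPart (δ e) ≡ negPart (γ e - δ e)
    μ·δ⁺≡γ″⁻ e = proj₁ (Step⁻-parts (steps e))
    μ·δ⁻≡γ⁻ : ∀ e → μ e ℕ.+ negPart (δ e) ≡ negPart (γ e)
    μ·δ⁻≡γ⁻ e = proj₁ (proj₂ (Step⁻-parts (steps e)))
    γ″⁺≡γ⁺ : ∀ e → posPart (γ e - δ e) ≡ posPart (γ e)
    γ″⁺≡γ⁺ e = proj₂ (proj₂ (Step⁻-parts (steps e)))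

lemma2p2 : ∀ {c ℓ : Level} (K : CommutativeRing c ℓ) → IsField K →
    ∀ (n k : ℕ) (z : Fin n → Fin k) (γ : ZVec n) →
    InKer z γ → ¬ (∀ e → γ e ≡ + 0) →
    let open Poly K n in
    ∃ λ (f' : Pol) → ∃ λ (f'' : Pol) → ∃ λ (γ'' : ZVec n) →
      InBinomialIdeal (InM z) f'
      × InBinomialIdeal (InKer z) f''
      × InKer z γ''
      × f'' ≡ binom γ''
      × degBinom γ'' ≡ degBinom γ
      × (binom γ ≈P (f' +P f''))
      × (∃ λ (u : Fin n) → ∃ λ (v : Fin n) → ∃ λ (w : Fin n) →
           z u ≡ z w
           × ((+ 0 < entry γ'' u v × entry γ'' v w < + 0)
              ⊎ (entry γ'' u v < + 0 × + 0 < entry γ'' v w)))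
lemma2p2 K _ n k z γ γ∈ker γ≢0 = decomposition K z γ∈ker (reduction γ∈ker γ≢0)
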